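{- If $G$ is a connected $P_5$-free chordal bipartite graph, then its complement $\overline{G}$ is a chordal graph.
   Context: Graphs are finite, simple and undirected. A bipartite graph is chordal bipartite if every cycle of length at least six has a chord. $P_5$-free means no induced path on five vertices. The complement $\overline{G}$ has vertex set $V(G)$ and edge set $\{\{u,v\}: u\ne v,\ \{u,v\}\notin E(G)\}$. A graph is chordal if it has no induced cycle of length at least four. -}

module Defs where

open import Data.Nat using (ℕ; zero; suc; _≤_)
open import Data.Nat.Properties using ()
open import Data.Fin using (Fin; toℕ)
open import Data.Bool using (Bool)
open import Data.Product using (_×_; Σ; ∃; _,_)
open import Data.Sum using (_⊎_)
open import Relation.Nullary using (¬_)
open import Relation.Binary.PropositionalEquality using (_≡_; _≢_; refl)
open import Function.Definitions using (Injective)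
open import Function.Bundles using (_⇔_)

record Graph (n : ℕ) : Set₁ where
  field
    Adj    : Fin n → Fin n → Set
    sym    : ∀ {u v} → Adj u v → Adj v u
    irrefl : ∀ {u} → ¬ Adj u u
open Graph public

complement : ∀ {n} → Graph n → Graph n
complement G = record
  { Adj    = λ u v → (u ≢ v) × ¬ Adj G u v
  ; sym    = λ { (u≢v , ¬a) → (λ e → u≢v (symm e)) , (λ a → ¬a (Graph.sym G a)) }
  ; irrefl = λ { (u≢u , _) → u≢u Relation.Binary.PropositionalEquality.refl }
  }
  where
  symm : ∀ {A : Set} {x y : A} → x ≡ y → y ≡ x
  symm = Relation.Binary.PropositionalEquality.sym

data Reachable {n} (G : Graph n) : Fin n → Fin n → Set where
  here : ∀ {u} → Reachable G u u
  step : ∀ {u v w} → Adj G u v → Reachable G v w → Reachable G u w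

Connected : ∀ {n} → Graph n → Set
Connected G = ∀ u v → Reachable G u v

Bipartite : ∀ {n} → Graph n → Set
Bipartite {n} G = Σ (Fin n → Bool) λ c → ∀ {u v} → Adj G u v → c u ≢ c v

CycNext : ∀ {k} → Fin k → Fin k → Set
CycNext {k} i j = suc (toℕ i) ≡ toℕ j ⊎ (suc (toℕ i) ≡ k × toℕ j ≡ 0)

CycConsecutive : ∀ {k} → Fin k → Fin k → Set
CycConsecutive i j = CycNext i j ⊎ CycNext j i

PathConsecutive : ∀ {k} → Fin k → Fin k → Set
PathConsecutive i j = suc (toℕ i) ≡ toℕ j ⊎ suc (toℕ j) ≡ toℕ i

record Cycle {n} (G : Graph n) (k : ℕ) : Set where
  field
    vtx   : Fin k → Fin n
    inj   : Injective _≡_ _≡_ vtx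
    edges : ∀ i j → CycNext i j → Adj G (vtx i) (vtx j)

HasChord : ∀ {n} {G : Graph n} {k} → Cycle G k → Set
HasChord {G = G} {k} C =
  Σ (Fin k) λ i → Σ (Fin k) λ j →
    ¬ CycConsecutive i j × Adj G (Cycle.vtx C i) (Cycle.vtx C j)

record InducedCycle {n} (G : Graph n) (k : ℕ) : Set where
  field
    vtx     : Fin k → Fin n
    inj     : Injective _≡_ _≡_ vtx
    induced : ∀ i j → Adj G (vtx i) (vtx j) ⇔ CycConsecutive i j

record InducedPath {n} (G : Graph n) (k : ℕ) : Set where
  field
    vtx     : Fin k → Fin n
    inj     : Injective _≡_ _≡_ vtx
    induced : ∀ i j → Adj G (vtx i) (vtx j) ⇔ PathConsecutive i j

P5Free : ∀ {n} → Graph n → Set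
P5Free G = ¬ InducedPath G 5

Chordal : ∀ {n} → Graph n → Set
Chordal G = ∀ k → 4 ≤ k → ¬ InducedCycle G k

ChordalBipartite : ∀ {n} → Graph n → Set
ChordalBipartite G = Bipartite G × (∀ k → 6 ≤ k → (C : Cycle G k) → HasChord C)

{-# OPTIONS --safe #-}
module Submission where

-- Let C be an induced cycle of length k ≥ 4 in the complement of a bipartite graph G.
-- Distinct, non-consecutive vertices of C are adjacent in G, so they get different
-- colours.  For k ≥ 6 the vertices v₀, v₂, v₄ would then need three colours, and for
-- k = 5 the vertices v₀ v₂ v₄ v₁ v₃ form an odd cycle of G.  For k = 4, v₀v₂ and v₁v₃
-- are edges of G with no edges between them, an induced 2K₂.  Along a walk from v₀
-- to v₁, the first vertex adjacent to v₁ or v₃ would close an induced P₅; so in a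
-- P₅-free bipartite graph an induced 2K₂ is never connected.

open import Data.Bool using (Bool)
open import Data.Bool.Properties using (¬-not)
open import Data.Empty using (⊥-elim)
open import Data.Fin using (Fin; toℕ; #_; _≟_)
open import Data.Fin.Patterns using (0F; 1F; 2F; 3F; 4F)
open import Data.Fin.Properties using (all?)
open import Data.Nat using (ℕ; suc; _+_; z≤n; s≤s)
import Data.Nat as ℕ
open import Data.Product using (_,_; proj₂)
open import Data.Vec using ([]; _∷_; lookup)
open import Function.Base using (_∘_; const)
open import Function.Bundles using (_⇔_; mk⇔; Equivalence)
open import Function.Definitions using (Injective)
import Function.Properties.Equivalence as ⇔
open import Relation.Nullary using (¬_; Dec; yes; no)
open import Relation.Nullary.Decidable
  using ( True; False; toWitness; toWitnessFalse; from-yes; map′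
        ; _×-dec_; _⊎-dec_; _→-dec_; ¬¬-excluded-middle )
open import Relation.Binary.PropositionalEquality using (_≡_; _≢_; subst)
import Relation.Binary.PropositionalEquality as ≡
open import Defs

two-colours : ∀ {a b c : Bool} → a ≢ b → b ≢ c → a ≡ c
two-colours a≢b b≢c = ≡.trans (¬-not a≢b) (≡.sym (¬-not (b≢c ∘ ≡.sym)))

_⇔-dec_ : ∀ {A B : Set} → Dec A → Dec B → Dec (A ⇔ B)
a? ⇔-dec b? = map′ (λ (f , g) → mk⇔ f g) (λ e → Equivalence.to e , Equivalence.from e)
                    ((a? →-dec b?) ×-dec (b? →-dec a?))

pathConsecutive? : ∀ {k} (i j : Fin k) → Dec (PathConsecutive i j)
pathConsecutive? i j = (suc (toℕ i) ℕ.≟ toℕ j) ⊎-dec (suc (toℕ j) ℕ.≟ toℕ i)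

cycNext? : ∀ {k} (i j : Fin k) → Dec (CycNext i j)
cycNext? {k} i j = (suc (toℕ i) ℕ.≟ toℕ j) ⊎-dec ((suc (toℕ i) ℕ.≟ k) ×-dec (toℕ j ℕ.≟ 0))

cycConsecutive? : ∀ {k} (i j : Fin k) → Dec (CycConsecutive i j)
cycConsecutive? i j = cycNext? i j ⊎-dec cycNext? j i

TwinFree : ∀ {k} → (Fin k → Fin k → Set) → Set
TwinFree R = ∀ i j → (∀ l → R i l ⇔ R j l) → i ≡ j

pathConsecutive-twinFree : TwinFree (PathConsecutive {5})
pathConsecutive-twinFree =
  from-yes (all? {5} λ i → all? λ j →
    all? (λ l → pathConsecutive? i l ⇔-dec pathConsecutive? j l) →-dec (i ≟ j))

module _ {n} (G : Graph n) where

  induced-injective : ∀ {k} {R : Fin k → Fin k → Set} (vtx : Fin k → Fin n) →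
    (∀ i j → Adj G (vtx i) (vtx j) ⇔ R i j) → TwinFree R → Injective _≡_ _≡_ vtx
  induced-injective {R = R} vtx induced twinFree {i} {j} vᵢ≡vⱼ = twinFree i j λ l →
    ⇔.trans (⇔.sym (induced i l))
            (subst (λ v → Adj G v (vtx l) ⇔ R j l) (≡.sym vᵢ≡vⱼ) (induced j l))

  inducedPath₅ : ∀ {v₀ v₁ v₂ v₃ v₄} →
    Adj G v₀ v₁ → Adj G v₁ v₂ → Adj G v₂ v₃ → Adj G v₃ v₄ →
    ¬ Adj G v₀ v₂ → ¬ Adj G v₀ v₃ → ¬ Adj G v₀ v₄ →
    ¬ Adj G v₁ v₃ → ¬ Adj G v₁ v₄ → ¬ Adj G v₂ v₄ → InducedPath G 5
  inducedPath₅ {v₀} {v₁} {v₂} {v₃} {v₄} e₀₁ e₁₂ e₂₃ e₃₄ n₀₂ n₀₃ n₀₄ n₁₃ n₁₄ n₂₄ = record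
    { vtx     = vtx
    ; inj     = induced-injective vtx induced pathConsecutive-twinFree
    ; induced = induced
    }
    where
    vtx : Fin 5 → Fin n
    vtx = lookup (v₀ ∷ v₁ ∷ v₂ ∷ v₃ ∷ v₄ ∷ [])

    edge : ∀ {i j} {_ : True (pathConsecutive? i j)} →
      Adj G (vtx i) (vtx j) → Adj G (vtx i) (vtx j) ⇔ PathConsecutive i j
    edge {i} {j} {c} a = mk⇔ (const (toWitness c)) (const a)

    nonedge : ∀ {i j} {_ : False (pathConsecutive? i j)} →
      ¬ Adj G (vtx i) (vtx j) → Adj G (vtx i) (vtx j) ⇔ PathConsecutive i j
    nonedge {i} {j} {c} na = mk⇔ (⊥-elim ∘ na) (⊥-elim ∘ toWitnessFalse c)

    induced : ∀ i j → Adj G (vtx i) (vtx j) ⇔ PathConsecutive i j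
    induced 0F 0F = nonedge (irrefl G)
    induced 0F 1F = edge e₀₁
    induced 0F 2F = nonedge n₀₂
    induced 0F 3F = nonedge n₀₃
    induced 0F 4F = nonedge n₀₄
    induced 1F 0F = edge (sym G e₀₁)
    induced 1F 1F = nonedge (irrefl G)
    induced 1F 2F = edge e₁₂
    induced 1F 3F = nonedge n₁₃
    induced 1F 4F = nonedge n₁₄
    induced 2F 0F = nonedge (n₀₂ ∘ sym G)
    induced 2F 1F = edge (sym G e₁₂)
    induced 2F 2F = nonedge (irrefl G)
    induced 2F 3F = edge e₂₃
    induced 2F 4F = nonedge n₂₄
    induced 3F 0F = nonedge (n₀₃ ∘ sym G)
    induced 3F 1F = nonedge (n₁₃ ∘ sym G)
    induced 3F 2F = edge (sym G e₂₃)
    induced 3F 3F = nonedge (irrefl G)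
    induced 3F 4F = edge e₃₄
    induced 4F 0F = nonedge (n₀₄ ∘ sym G)
    induced 4F 1F = nonedge (n₁₄ ∘ sym G)
    induced 4F 2F = nonedge (n₂₄ ∘ sym G)
    induced 4F 3F = edge (sym G e₃₄)
    induced 4F 4F = nonedge (irrefl G)

record Induced2K₂ {n} (G : Graph n) (x y c d : Fin n) : Set where
  field
    x~y : Adj G x y
    c~d : Adj G c d
    x≁c : ¬ Adj G x c
    x≁d : ¬ Adj G x d
    y≁c : ¬ Adj G y c
    y≁d : ¬ Adj G y d

module _ {n} {G : Graph n} where

  induced2K₂-swapʳ : ∀ {x y c d} → Induced2K₂ G x y c d → Induced2K₂ G x y d c
  induced2K₂-swapʳ K = record
    { x~y = x~y ; c~d = sym G c~d ; x≁c = x≁d ; x≁d = x≁c ; y≁c = y≁d ; y≁d = y≁c }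
    where open Induced2K₂ K

  induced2K₂-step : ∀ {x y c d w} → Induced2K₂ G x y c d →
    Adj G x w → ¬ Adj G w c → ¬ Adj G w d → Induced2K₂ G w x c d
  induced2K₂-step K x~w w≁c w≁d = record
    { x~y = sym G x~w ; c~d = c~d ; x≁c = w≁c ; x≁d = w≁d ; y≁c = x≁c ; y≁d = x≁d }
    where open Induced2K₂ K

module ProperColouring {n} (G : Graph n) (colour : Fin n → Bool)
  (proper : ∀ {u v} → Adj G u v → colour u ≢ colour v) where

  common-neighbours-nonadjacent : ∀ {x y z} → Adj G x y → Adj G x z → ¬ Adj G y z
  common-neighbours-nonadjacent x~y x~z y~z =
    proper y~z (two-colours (proper x~y ∘ ≡.sym) (proper x~z))

  complement-nonadjacent⇒colours-differ : ∀ {u v} →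
    u ≢ v → ¬ Adj (complement G) u v → colour u ≢ colour v
  complement-nonadjacent⇒colours-differ u≢v u≁v same = u≁v (u≢v , λ u~v → proper u~v same)

  module _ (P₅-free : P5Free G) where

    induced2K₂-bridge⇒P₅ : ∀ {x y c d w} → Induced2K₂ G x y c d →
      Adj G x w → Adj G w c → InducedPath G 5
    induced2K₂-bridge⇒P₅ K x~w w~c = inducedPath₅ G (sym G x~y) x~w w~c c~d
      (common-neighbours-nonadjacent x~y x~w) y≁c y≁d x≁c x≁d
      (common-neighbours-nonadjacent (sym G w~c) c~d)
      where open Induced2K₂ K

    induced2K₂⇒unreachable : ∀ {x y c d} → Induced2K₂ G x y c d → ¬ Reachable G x c
    induced2K₂⇒unreachable K here = Induced2K₂.x≁d K (Induced2K₂.c~d K)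
    induced2K₂⇒unreachable {c = c} {d} K (step {v = w} x~w w⇝c) =
      ¬¬-excluded-middle {A = Adj G w c} λ where
        (yes w~c) → P₅-free (induced2K₂-bridge⇒P₅ K x~w w~c)
        (no w≁c) → ¬¬-excluded-middle {A = Adj G w d} λ where
          (yes w~d) → P₅-free (induced2K₂-bridge⇒P₅ (induced2K₂-swapʳ K) x~w w~d)
          (no w≁d) → induced2K₂⇒unreachable (induced2K₂-step K x~w w≁c w≁d) w⇝c

  module Complement-hole {k} (C : InducedCycle (complement G) k) where
    open InducedCycle C

    consecutive-nonadjacent : ∀ i j {_ : True (cycConsecutive? i j)} → ¬ Adj G (vtx i) (vtx j)
    consecutive-nonadjacent i j {c} = proj₂ (Equivalence.from (induced i j) (toWitness c))

    nonconsecutive-complement-nonadjacent : ∀ i j {_ : False (cycConsecutive? i j)} →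
      ¬ Adj (complement G) (vtx i) (vtx j)
    nonconsecutive-complement-nonadjacent i j {c} = toWitnessFalse c ∘ Equivalence.to (induced i j)

    far-adjacent : ∀ i j {_ : False (i ≟ j)} {_ : False (cycConsecutive? i j)} →
      ¬ ¬ Adj G (vtx i) (vtx j)
    far-adjacent i j {i≢j} {c} vᵢ≁vⱼ =
      nonconsecutive-complement-nonadjacent i j {c} (toWitnessFalse i≢j ∘ inj , vᵢ≁vⱼ)

    far-colours-differ : ∀ i j {_ : False (i ≟ j)} {_ : False (cycConsecutive? i j)} →
      colour (vtx i) ≢ colour (vtx j)
    far-colours-differ i j {i≢j} {c} =
      complement-nonadjacent⇒colours-differ (toWitnessFalse i≢j ∘ inj)
        (nonconsecutive-complement-nonadjacent i j {c})

  complement-C₅-free : ¬ InducedCycle (complement G) 5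
  complement-C₅-free C = far-colours-differ (# 0) (# 3)
    (≡.trans (two-colours (far-colours-differ (# 0) (# 2)) (far-colours-differ (# 2) (# 4)))
             (two-colours (far-colours-differ (# 4) (# 1)) (far-colours-differ (# 1) (# 3))))
    where open Complement-hole C

  complement-long-hole-free : ∀ m → ¬ InducedCycle (complement G) (6 + m)
  complement-long-hole-free m C =
    far-colours-differ (# 0) (# 4)
      (two-colours (far-colours-differ (# 0) (# 2)) (far-colours-differ (# 2) (# 4)))
    where open Complement-hole C

  complement-C₄-free : Connected G → P5Free G → ¬ InducedCycle (complement G) 4
  complement-C₄-free connected P₅-free C =
    far-adjacent (# 0) (# 2) λ v₀~v₂ → far-adjacent (# 1) (# 3) λ v₁~v₃ →
      induced2K₂⇒unreachable P₅-free (record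
        { x~y = v₀~v₂ ; c~d = v₁~v₃
        ; x≁c = consecutive-nonadjacent (# 0) (# 1) ; x≁d = consecutive-nonadjacent (# 0) (# 3)
        ; y≁c = consecutive-nonadjacent (# 2) (# 1) ; y≁d = consecutive-nonadjacent (# 2) (# 3) })
      (connected _ _)
    where open Complement-hole C

theorem16 : ∀ (n : ℕ) (G : Graph n) → Connected G → P5Free G → ChordalBipartite G →
    Chordal (complement G)
theorem16 n G connected P₅-free ((colour , proper) , _) _ (s≤s (s≤s (s≤s (s≤s {n = m} z≤n)))) =
  complement-hole-free m
  where
  open ProperColouring G colour proper
  complement-hole-free : ∀ m → ¬ InducedCycle (complement G) (4 + m)
  complement-hole-free 0 = complement-C₄-free connected P₅-free
  complement-hole-free 1 = complement-C₅-free
  complement-hole-free (suc (suc m)) = complement-long-hole-free m
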